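{- Let $G$ be a connected graph with a cut edge $e'=v_1v_2$, and let $G_1$, $G_2$ be the components of $G-e'$ containing $v_1$ and $v_2$ respectively, with $|E(G_i)|=m_i$. Let $G'$ be the graph obtained from $G$ by contracting the edge $e'$ (into a single vertex $w$) and adding a new pendant edge attached at $w$. If $d_G(v_i)\ge 2$ for $i=1,2$, then $W_e(G')<W_e(G)$.
   Context: For a connected graph $G$ and edges $f=u_1u_2$, $g=v_1v_2$, $d_G(f,g)=\min\{d_G(u_i,v_j): i,j\in\{1,2\}\}+1$ if $f\neq g$, and $d_G(f,f)=0$; $W_e(G)=\sum_{\{f,g\}\subseteq E(G)} d_G(f,g)$ over unordered pairs of edges. -}

module Defs where

open import Data.Bool using (Bool; true; false; _∧_; _∨_; not; if_then_else_)
open import Data.Nat using (ℕ; zero; suc; _+_; _⊓_; _<ᵇ_)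
open import Data.Fin using (Fin; toℕ; _≟_)
open import Data.List using (List; []; _∷_; [_]; concatMap; map; filter; length; upTo)
open import Data.Bool.ListAction using (any)
open import Data.Nat.ListAction using (sum)
open import Data.List using () renaming (allFin to allFinL)
open import Data.Product using (_×_; _,_; Σ)
open import Relation.Nullary using (¬_)
open import Relation.Nullary.Decidable using (⌊_⌋)
open import Relation.Binary.PropositionalEquality using (_≡_)

Graph : ℕ → Set
Graph n = Fin n → Fin n → Bool

record IsSimple {n : ℕ} (G : Graph n) : Set where
  field
    symm    : ∀ x y → G x y ≡ G y x
    irrefl  : ∀ x → G x x ≡ false

_==_ : ∀ {n} → Fin n → Fin n → Bool
x == y = ⌊ x ≟ y ⌋

reach : ∀ {n} → Graph n → ℕ → Fin n → Fin n → Bool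
reach G zero    u v = u == v
reach G (suc k) u v = reach G k u v ∨ any (λ w → G u w ∧ reach G k w v) (allFinL _)

Connected : ∀ {n} → Graph n → Set
Connected G = ∀ u v → Σ ℕ (λ k → reach G k u v ≡ true)

-- Shortest-path distance: the least k with reach G k u v (for a connected graph
-- on n vertices this is < n), computed as the number of k < n for which
-- u does not reach v within k steps.
dist : ∀ {n} → Graph n → Fin n → Fin n → ℕ
dist {n} G u v = length (filter (λ k → not (reach G k u v) ≡? true) (upTo n))
  where
  open import Data.Bool.Properties using () renaming (_≟_ to _≡?_)

deg : ∀ {n} → Graph n → Fin n → ℕ
deg G v = length (filter (λ w → G v w ≡? true) (allFinL _))
  where
  open import Data.Bool.Properties using () renaming (_≟_ to _≡?_)

Edge : ℕ → Set
Edge n = Fin n × Fin n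

edges : ∀ {n} → Graph n → List (Edge n)
edges {n} G = concatMap (λ i → concatMap (λ j →
                if (toℕ i <ᵇ toℕ j) ∧ G i j then [ (i , j) ] else [])
                (allFinL n)) (allFinL n)

edist : ∀ {n} → Graph n → Edge n → Edge n → ℕ
edist G (u₁ , u₂) (v₁ , v₂) =
  suc ((dist G u₁ v₁ ⊓ dist G u₁ v₂) ⊓ (dist G u₂ v₁ ⊓ dist G u₂ v₂))

pairSum : ∀ {n} → Graph n → List (Edge n) → ℕ
pairSum G []       = 0
pairSum G (e ∷ es) = sum (map (edist G e) es) + pairSum G es

We : ∀ {n} → Graph n → ℕ
We G = pairSum G (edges G)

deleteEdge : ∀ {n} → Graph n → Fin n → Fin n → Graph n
deleteEdge G v₁ v₂ x y = G x y ∧ not ((x == v₁ ∧ y == v₂) ∨ (x == v₂ ∧ y == v₁))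

IsCutEdge : ∀ {n} → Graph n → Fin n → Fin n → Set
IsCutEdge G v₁ v₂ = ¬ Connected (deleteEdge G v₁ v₂)

-- Realised on the same vertex set Fin n: vertex v1 plays the role of w, and
-- vertex v2 is reused as the new pendant vertex, adjacent only to w.
-- w is adjacent to every vertex (≠ v1, v2) adjacent in G to v1 or v2.
contractPendant : ∀ {n} → Graph n → Fin n → Fin n → Graph n
contractPendant G v₁ v₂ x y =
  if x == v₂ then y == v₁ else
  if y == v₂ then x == v₁ else
  (not (x == y) ∧ (G x y ∨ (x == v₁ ∧ G v₂ y) ∨ (y == v₁ ∧ G x v₂)))

module Submission where

-- Merging v₂ into v₁ is a graph homomorphism G → G′, so it does not increase distances.
-- Send each edge of G′ to the edge of G it comes from: the pendant edge to v₁v₂, an edge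
-- v₁y that v₁ inherited from v₂ back to v₂y, every other edge to itself. This is injective,
-- and merging maps the ends of the image of an edge onto its ends, so edge distances in G′
-- are at most those of the images in G. By the degree hypotheses, v₁ has a neighbour a ≠ v₂
-- and v₂ a neighbour b ≠ v₁; b is not adjacent to v₁, for otherwise deleting v₁v₂ would
-- leave G connected. The edges v₁a and v₁b of G′ share v₁, while their images v₁a and v₂b
-- are disjoint, so for this pair the inequality is strict.

open import Defs
open import Algebra.Properties.CommutativeSemigroup using (interchange)
open import Data.Bool using (Bool; true; false; _∧_; _∨_; not; if_then_else_)
open import Data.Bool.Properties using (∨-zeroʳ; T-≡) renaming (_≟_ to _≟ᵇ_)
open import Data.Empty using (⊥-elim)
open import Data.Fin using (Fin; toℕ; _≟_)
open import Data.Fin.Properties using (toℕ-injective)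
open import Data.List using (List; []; _∷_; [_]; _++_; map; length; concatMap; upTo)
open import Data.List using () renaming (allFin to allFinL)
open import Data.List.Properties using (filter-none; map-∘)
open import Data.List.Membership.Propositional using (_∈_; lose; find)
open import Data.List.Membership.Propositional.Properties using (∈-allFin; ∈-∃++; ∈-concatMap⁺; ∈-concatMap⁻; ∈-filter⁻; ∈-map⁻)
open import Data.List.Relation.Binary.Permutation.Propositional using (_↭_; refl; prep; swap; trans)
open import Data.List.Relation.Binary.Permutation.Propositional.Properties using (shift; ∈-resp-↭) renaming (map⁺ to ↭-map⁺)
open import Data.List.Relation.Binary.Subset.Propositional using (_⊆_)
open import Data.List.Relation.Binary.Sublist.Propositional using (⊆-refl)
open import Data.List.Relation.Binary.Sublist.Propositional.Properties using (filter⁺)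
open import Data.List.Relation.Binary.Sublist.Heterogeneous.Properties using (length-mono-≤)
open import Data.List.Relation.Unary.All as All using (All; []; _∷_)
open import Data.List.Relation.Unary.All.Properties using () renaming (map⁺ to All-map⁺)
open import Data.List.Relation.Unary.Any using (here; there)
open import Data.List.Relation.Unary.Any.Properties using (any⁺; any⁻)
open import Data.List.Relation.Unary.Unique.Propositional using (Unique; []; _∷_)
open import Data.List.Relation.Unary.Unique.Propositional.Properties using (allFin⁺; ++⁺) renaming (filter⁺ to Unique-filter⁺)
open import Data.Nat using (ℕ; zero; suc; _+_; _≤_; _<_; z≤n; s≤s; _⊓_; _<ᵇ_)
open import Data.Nat.ListAction using (sum)
open import Data.Nat.ListAction.Properties using (sum-↭)
open import Data.Nat.Properties using (module ≤-Reasoning; ≤-trans; ≤-antisym; +-suc; m⊓n≤m; m⊓n≤n; ⊓-glb; +-mono-≤; +-mono-<-≤; +-mono-≤-<; +-monoʳ-≤; <-asym; <-cmp; <ᵇ⇒<; <⇒<ᵇ; +-commutativeSemigroup)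
open import Data.Product using (_×_; _,_; ∃; proj₁; proj₂)
open import Data.Sum as Sum using (_⊎_; inj₁; inj₂)
open import Function.Base using (_∘_)
open import Function.Bundles using (Equivalence)
open import Relation.Binary.PropositionalEquality as Eq using (_≡_; _≢_; refl; sym; cong; cong₂; subst; module ≡-Reasoning)
open import Relation.Nullary using (¬_; Dec; yes; no)
open import Relation.Binary.Definitions using (DecidableEquality; tri<; tri≈; tri>)

private
  variable
    A : Set
    n k : ℕ

==-refl : (x : Fin n) → x == x ≡ true
==-refl x with x ≟ x
... | yes _  = refl
... | no x≢x = ⊥-elim (x≢x refl)

≢⇒==-false : {x y : Fin n} → x ≢ y → x == y ≡ false
≢⇒==-false {x = x} {y} x≢y with x ≟ y
... | yes x≡y = ⊥-elim (x≢y x≡y)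
... | no _    = refl

==⇒≡ : {x y : Fin n} → x == y ≡ true → x ≡ y
==⇒≡ {x = x} {y} eq with x ≟ y
... | yes x≡y = x≡y

∨-true⁻ : ∀ {a b} → a ∨ b ≡ true → a ≡ true ⊎ b ≡ true
∨-true⁻ {true}  _ = inj₁ refl
∨-true⁻ {false} p = inj₂ p

∧-true⁻ : ∀ {a b} → a ∧ b ≡ true → a ≡ true × b ≡ true
∧-true⁻ {true} p = refl , p

∨-trueʳ : ∀ {a b} → b ≡ true → a ∨ b ≡ true
∨-trueʳ {a} refl = ∨-zeroʳ a

adjacent⇒≢ : {G : Graph n} → IsSimple G → ∀ {x y} → G x y ≡ true → x ≢ y
adjacent⇒≢ {G = G} s {x} g refl with subst (_≡ true) (IsSimple.irrefl s x) g
... | ()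

adjacent-sym : {G : Graph n} → IsSimple G → ∀ {x y} → G x y ≡ true → G y x ≡ true
adjacent-sym s {x} {y} = subst (_≡ true) (IsSimple.symm s x y)

module _ (G : Graph n) where

  reach-suc : ∀ k {u v} → reach G k u v ≡ true → reach G (suc k) u v ≡ true
  reach-suc k p rewrite p = refl

  reach-step : ∀ k {u w v} → G u w ≡ true → reach G k w v ≡ true → reach G (suc k) u v ≡ true
  reach-step k {w = w} guw rwv = ∨-trueʳ (Equivalence.to T-≡
    (any⁺ _ (lose (∈-allFin w) (Equivalence.from T-≡ (cong₂ _∧_ guw rwv)))))

  reach-suc⁻ : ∀ k {u v} → reach G (suc k) u v ≡ true →
               reach G k u v ≡ true ⊎ ∃ λ w → G u w ≡ true × reach G k w v ≡ true
  reach-suc⁻ k {u} {v} r with ∨-true⁻ {reach G k u v} r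
  ... | inj₁ r′ = inj₁ r′
  ... | inj₂ a with find (any⁻ _ (allFinL _) (Equivalence.from T-≡ a))
  ...   | w , _ , t = inj₂ (w , ∧-true⁻ (Equivalence.to T-≡ t))

  reach-refl : ∀ k u → reach G k u u ≡ true
  reach-refl zero    u = ==-refl u
  reach-refl (suc k) u = reach-suc k (reach-refl k u)

  reach-+ : ∀ j k {u v} → reach G k u v ≡ true → reach G (j + k) u v ≡ true
  reach-+ zero    k r = r
  reach-+ (suc j) k r = reach-suc (j + k) (reach-+ j k r)

  reach-stepʳ : ∀ k {u w v} → reach G k u w ≡ true → G w v ≡ true → reach G (suc k) u v ≡ true
  reach-stepʳ zero r g rewrite ==⇒≡ r = reach-step 0 g (reach-refl 0 _)
  reach-stepʳ (suc k) r g with reach-suc⁻ k r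
  ... | inj₁ r′               = reach-suc (suc k) (reach-stepʳ k r′ g)
  ... | inj₂ (x , gux , rxw) = reach-step (suc k) gux (reach-stepʳ k rxw g)

  reach-sym : IsSimple G → ∀ k {u v} → reach G k u v ≡ true → reach G k v u ≡ true
  reach-sym s zero r rewrite ==⇒≡ r = reach-refl 0 _
  reach-sym s (suc k) r with reach-suc⁻ k r
  ... | inj₁ r′               = reach-suc k (reach-sym s k r′)
  ... | inj₂ (x , gux , rxv) =
    reach-stepʳ k (reach-sym s k rxv) (adjacent-sym s gux)

reach-map : ∀ {m} (G : Graph n) (H : Graph m) (φ : Fin n → Fin m) →
            (∀ {x y} → G x y ≡ true → φ x ≡ φ y ⊎ H (φ x) (φ y) ≡ true) →
            ∀ k {u v} → reach G k u v ≡ true → reach H k (φ u) (φ v) ≡ true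
reach-map G H φ hom zero r rewrite ==⇒≡ r = reach-refl H 0 _
reach-map G H φ hom (suc k) r with reach-suc⁻ G k r
... | inj₁ r′ = reach-suc H k (reach-map G H φ hom k r′)
... | inj₂ (x , gux , rxv) with hom gux
...   | inj₁ φu≡φx rewrite φu≡φx = reach-suc H k (reach-map G H φ hom k rxv)
...   | inj₂ hux = reach-step H k hux (reach-map G H φ hom k rxv)

module _ (G : Graph n) (v₁ v₂ : Fin n) where

  deleteEdge-split : ∀ {x y} → G x y ≡ true →
    deleteEdge G v₁ v₂ x y ≡ true ⊎ (x ≡ v₁ × y ≡ v₂ ⊎ x ≡ v₂ × y ≡ v₁)
  deleteEdge-split {x} {y} g with (x == v₁ ∧ y == v₂) ∨ (x == v₂ ∧ y == v₁) in e
  ... | false rewrite g = inj₁ refl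
  ... | true with ∨-true⁻ {x == v₁ ∧ y == v₂} e
  ...   | inj₁ e₁ = let p , q = ∧-true⁻ e₁ in inj₂ (inj₁ (==⇒≡ p , ==⇒≡ q))
  ...   | inj₂ e₂ = let p , q = ∧-true⁻ e₂ in inj₂ (inj₂ (==⇒≡ p , ==⇒≡ q))

  deleteEdge-keep : ∀ {x y} → G x y ≡ true → (x ≢ v₁ × x ≢ v₂) ⊎ (y ≢ v₁ × y ≢ v₂) →
                    deleteEdge G v₁ v₂ x y ≡ true
  deleteEdge-keep g outside with deleteEdge-split g
  ... | inj₁ d = d
  deleteEdge-keep g (inj₁ (x≢v₁ , _)) | inj₂ (inj₁ (x≡v₁ , _)) = ⊥-elim (x≢v₁ x≡v₁)
  deleteEdge-keep g (inj₁ (_ , x≢v₂)) | inj₂ (inj₂ (x≡v₂ , _)) = ⊥-elim (x≢v₂ x≡v₂)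
  deleteEdge-keep g (inj₂ (_ , y≢v₂)) | inj₂ (inj₁ (_ , y≡v₂)) = ⊥-elim (y≢v₂ y≡v₂)
  deleteEdge-keep g (inj₂ (y≢v₁ , _)) | inj₂ (inj₂ (_ , y≡v₁)) = ⊥-elim (y≢v₁ y≡v₁)

module _ {G : Graph n} (s : IsSimple G) {v₁ v₂ b : Fin n}
         (g₁ : G v₁ b ≡ true) (g₂ : G v₂ b ≡ true) where

  private
    D : Graph n
    D = deleteEdge G v₁ v₂

    b≢v₁ : b ≢ v₁
    b≢v₁ b≡v₁ = adjacent⇒≢ s g₁ (sym b≡v₁)

    b≢v₂ : b ≢ v₂
    b≢v₂ b≡v₂ = adjacent⇒≢ s g₂ (sym b≡v₂)

    to-b : ∀ {v} → G v b ≡ true → D v b ≡ true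
    to-b g = deleteEdge-keep G v₁ v₂ g (inj₂ (b≢v₁ , b≢v₂))

    from-b : ∀ {v} → G v b ≡ true → D b v ≡ true
    from-b g = deleteEdge-keep G v₁ v₂ (adjacent-sym s g) (inj₁ (b≢v₁ , b≢v₂))

  -- Every step along v₁v₂ is replaced by the two-step detour through b.
  reach-deleteEdge-triangle : ∀ k {x y} → reach G k x y ≡ true → reach D (k + k) x y ≡ true
  reach-deleteEdge-triangle zero r = r
  reach-deleteEdge-triangle (suc k) r rewrite +-suc k k with reach-suc⁻ G k r
  ... | inj₁ r′ = reach-+ D 2 (k + k) (reach-deleteEdge-triangle k r′)
  ... | inj₂ (w , guw , rwy) with deleteEdge-split G v₁ v₂ guw
  ...   | inj₁ duw = reach-suc D (suc (k + k)) (reach-step D (k + k) duw (reach-deleteEdge-triangle k rwy))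
  ...   | inj₂ (inj₁ (refl , refl)) =
    reach-step D (suc (k + k)) (to-b g₁) (reach-step D (k + k) (from-b g₂) (reach-deleteEdge-triangle k rwy))
  ...   | inj₂ (inj₂ (refl , refl)) =
    reach-step D (suc (k + k)) (to-b g₂) (reach-step D (k + k) (from-b g₁) (reach-deleteEdge-triangle k rwy))

  connected-deleteEdge-triangle : Connected G → Connected D
  connected-deleteEdge-triangle conn x y =
    let k , r = conn x y in k + k , reach-deleteEdge-triangle k r

dist-mono : (G H : Graph n) {a b c d : Fin n} →
            (∀ k → reach G k a b ≡ true → reach H k c d ≡ true) → dist H c d ≤ dist G a b
dist-mono {n} G H {a} {b} {c} {d} imp =
  length-mono-≤ (filter⁺ (λ k → not (reach H k c d) ≟ᵇ true) (λ k → not (reach G k a b) ≟ᵇ true)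
                         unreachable (⊆-refl {x = upTo n}))
  where
  unreachable : ∀ {k j} → k ≡ j → not (reach H k c d) ≡ true → not (reach G j a b) ≡ true
  unreachable {k} refl ¬r with reach G k a b in r
  ... | false = refl
  ... | true rewrite imp k r = ¬r

dist-sym : {G : Graph n} → IsSimple G → ∀ a b → dist G a b ≡ dist G b a
dist-sym {G = G} s a b = ≤-antisym (dist-mono G G (λ k → reach-sym G s k))
                                   (dist-mono G G (λ k → reach-sym G s k))

dist-refl : (G : Graph n) (a : Fin n) → dist G a a ≡ 0
dist-refl {n} G a =
  cong length (filter-none (λ k → not (reach G k a a) ≟ᵇ true) (All.universal reachable (upTo n)))
  where
  reachable : ∀ k → not (reach G k a a) ≢ true
  reachable k ¬r rewrite reach-refl G k a with ¬r
  ... | ()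

dist-pos : (G : Graph n) {a b : Fin n} → a ≢ b → 1 ≤ dist G a b
dist-pos {suc n} G a≢b rewrite ≢⇒==-false a≢b = s≤s z≤n

infix 4 _∈ᵉ_

_∈ᵉ_ : Fin n → Edge n → Set
x ∈ᵉ (u , v) = x ≡ u ⊎ x ≡ v

edist≤1+dist : (H : Graph n) (e f : Edge n) {c d : Fin n} → c ∈ᵉ e → d ∈ᵉ f →
               edist H e f ≤ suc (dist H c d)
edist≤1+dist H e f c∈e d∈f = s≤s (pick c∈e d∈f)
  where
  pick : ∀ {c d} → c ∈ᵉ e → d ∈ᵉ f →
         (dist H _ _ ⊓ dist H _ _) ⊓ (dist H _ _ ⊓ dist H _ _) ≤ dist H c d
  pick (inj₁ refl) (inj₁ refl) = ≤-trans (m⊓n≤m _ _) (m⊓n≤m _ _)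
  pick (inj₁ refl) (inj₂ refl) = ≤-trans (m⊓n≤m _ _) (m⊓n≤n _ _)
  pick (inj₂ refl) (inj₁ refl) = ≤-trans (m⊓n≤n _ _) (m⊓n≤m _ _)
  pick (inj₂ refl) (inj₂ refl) = ≤-trans (m⊓n≤n _ _) (m⊓n≤n _ _)

edist-glb : (H : Graph n) (e f : Edge n) {m : ℕ} →
            (∀ {c d} → c ∈ᵉ e → d ∈ᵉ f → m ≤ suc (dist H c d)) → m ≤ edist H e f
edist-glb H e f bound =
  ⊓-glb (⊓-glb (bound (inj₁ refl) (inj₁ refl)) (bound (inj₁ refl) (inj₂ refl)))
        (⊓-glb (bound (inj₂ refl) (inj₁ refl)) (bound (inj₂ refl) (inj₂ refl)))

edist-sym : {G : Graph n} → IsSimple G → ∀ e f → edist G e f ≡ edist G f e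
edist-sym {G = G} s e f = ≤-antisym (edist-≤-swap e f) (edist-≤-swap f e)
  where
  edist-≤-swap : ∀ e f → edist G e f ≤ edist G f e
  edist-≤-swap e f = edist-glb G f e λ c∈f d∈e →
    subst (λ m → edist G e f ≤ suc m) (dist-sym s _ _) (edist≤1+dist G e f d∈e c∈f)

edist-shared : (H : Graph n) (e f : Edge n) {c : Fin n} → c ∈ᵉ e → c ∈ᵉ f → edist H e f ≤ 1
edist-shared H e f {c} c∈e c∈f =
  subst (λ m → edist H e f ≤ suc m) (dist-refl H c) (edist≤1+dist H e f c∈e c∈f)

edist-disjoint : (H : Graph n) (e f : Edge n) → (∀ {c d} → c ∈ᵉ e → d ∈ᵉ f → c ≢ d) → 2 ≤ edist H e f
edist-disjoint H e f disjoint = edist-glb H e f λ c∈e d∈f → s≤s (dist-pos H (disjoint c∈e d∈f))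

sumPairs : (A → A → ℕ) → List A → ℕ
sumPairs w []       = 0
sumPairs w (x ∷ xs) = sum (map (w x) xs) + sumPairs w xs

pairSum≡sumPairs : (G : Graph n) (es : List (Edge n)) → pairSum G es ≡ sumPairs (edist G) es
pairSum≡sumPairs G []       = refl
pairSum≡sumPairs G (e ∷ es) = cong (sum (map (edist G e) es) +_) (pairSum≡sumPairs G es)

∈⇒↭∷ : {x : A} {ys : List A} → x ∈ ys → ∃ λ zs → ys ↭ x ∷ zs
∈⇒↭∷ {x = x} x∈ys with ∈-∃++ x∈ys
... | as , bs , refl = as ++ bs , shift x as bs

sum-map-↭ : (f : A → ℕ) {xs ys : List A} → xs ↭ ys → sum (map f xs) ≡ sum (map f ys)
sum-map-↭ f p = sum-↭ (↭-map⁺ f p)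

sum-map-mono-≤ : (f g : A → ℕ) (xs : List A) → (∀ {x} → x ∈ xs → f x ≤ g x) →
                 sum (map f xs) ≤ sum (map g xs)
sum-map-mono-≤ f g []       f≤g = z≤n
sum-map-mono-≤ f g (x ∷ xs) f≤g = +-mono-≤ (f≤g (here refl)) (sum-map-mono-≤ f g xs (f≤g ∘ there))

sum-map-mono-< : (f g : A → ℕ) {xs : List A} {x : A} → x ∈ xs → f x < g x →
                 (∀ {x} → x ∈ xs → f x ≤ g x) → sum (map f xs) < sum (map g xs)
sum-map-mono-< f g {_ ∷ xs} (here refl) fx<gx f≤g =
  +-mono-<-≤ fx<gx (sum-map-mono-≤ f g xs (f≤g ∘ there))
sum-map-mono-< f g (there x∈xs) fx<gx f≤g =
  +-mono-≤-< (f≤g (here refl)) (sum-map-mono-< f g x∈xs fx<gx (f≤g ∘ there))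

∷⊆↭∷⇒⊆ : {x : A} {xs ys zs : List A} → All (x ≢_) xs → ys ↭ x ∷ zs → x ∷ xs ⊆ ys → xs ⊆ zs
∷⊆↭∷⇒⊆ x∉xs ys↭x∷zs x∷xs⊆ys y∈xs with ∈-resp-↭ ys↭x∷zs (x∷xs⊆ys (there y∈xs))
... | here y≡x   = ⊥-elim (All.lookup x∉xs y∈xs (sym y≡x))
... | there y∈zs = y∈zs

sum-map-⊆ : (f : A → ℕ) {xs ys : List A} → Unique xs → xs ⊆ ys → sum (map f xs) ≤ sum (map f ys)
sum-map-⊆ f {[]}     _            _  = z≤n
sum-map-⊆ f {x ∷ xs} (x∉xs ∷ uxs) xs⊆ys with ∈⇒↭∷ (xs⊆ys (here refl))
... | zs , ys↭x∷zs rewrite sum-map-↭ f ys↭x∷zs =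
  +-monoʳ-≤ (f x) (sum-map-⊆ f uxs (∷⊆↭∷⇒⊆ x∉xs ys↭x∷zs xs⊆ys))

module _ (w : A → A → ℕ) where

  sumPairs-↭ : (∀ x y → w x y ≡ w y x) → {xs ys : List A} → xs ↭ ys → sumPairs w xs ≡ sumPairs w ys
  sumPairs-↭ w-sym refl         = refl
  sumPairs-↭ w-sym (prep x p)   = cong₂ _+_ (sum-map-↭ (w x) p) (sumPairs-↭ w-sym p)
  sumPairs-↭ w-sym (trans p q)  = Eq.trans (sumPairs-↭ w-sym p) (sumPairs-↭ w-sym q)
  sumPairs-↭ w-sym {x ∷ y ∷ xs} {_ ∷ _ ∷ ys} (swap x y p) = begin
    (w x y + Sx) + (Sy + sumPairs w xs)   ≡⟨ interchange +-commutativeSemigroup (w x y) Sx Sy _ ⟩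
    (w x y + Sy) + (Sx + sumPairs w xs)   ≡⟨ cong₂ _+_ (cong₂ _+_ (w-sym x y) (sum-map-↭ (w y) p))
                                                       (cong₂ _+_ (sum-map-↭ (w x) p) (sumPairs-↭ w-sym p)) ⟩
    (w y x + Sy′) + (Sx′ + sumPairs w ys) ∎
    where
    open ≡-Reasoning
    Sx  = sum (map (w x) xs)
    Sy  = sum (map (w y) xs)
    Sx′ = sum (map (w x) ys)
    Sy′ = sum (map (w y) ys)

  sumPairs-⊆ : (∀ x y → w x y ≡ w y x) → {xs ys : List A} → Unique xs → xs ⊆ ys →
               sumPairs w xs ≤ sumPairs w ys
  sumPairs-⊆ w-sym {[]}     _            _     = z≤n
  sumPairs-⊆ w-sym {x ∷ xs} (x∉xs ∷ uxs) xs⊆ys with ∈⇒↭∷ (xs⊆ys (here refl))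
  ... | zs , ys↭x∷zs rewrite sumPairs-↭ w-sym ys↭x∷zs =
    +-mono-≤ (sum-map-⊆ (w x) uxs xs⊆zs) (sumPairs-⊆ w-sym uxs xs⊆zs)
    where xs⊆zs = ∷⊆↭∷⇒⊆ x∉xs ys↭x∷zs xs⊆ys

sumPairs-map : (w : A → A → ℕ) (ψ : A → A) (xs : List A) →
               sumPairs w (map ψ xs) ≡ sumPairs (λ x y → w (ψ x) (ψ y)) xs
sumPairs-map w ψ []       = refl
sumPairs-map w ψ (x ∷ xs) = cong₂ _+_ (cong sum (Eq.sym (map-∘ xs))) (sumPairs-map w ψ xs)

module _ (w w′ : A → A → ℕ) where

  sumPairs-mono-≤ : (xs : List A) → (∀ {x y} → x ∈ xs → y ∈ xs → w x y ≤ w′ x y) →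
                    sumPairs w xs ≤ sumPairs w′ xs
  sumPairs-mono-≤ []       w≤w′ = z≤n
  sumPairs-mono-≤ (x ∷ xs) w≤w′ =
    +-mono-≤ (sum-map-mono-≤ (w x) (w′ x) xs (w≤w′ (here refl) ∘ there))
             (sumPairs-mono-≤ xs λ x∈ y∈ → w≤w′ (there x∈) (there y∈))

  sumPairs-mono-< : {xs : List A} {x y : A} → x ∈ xs → y ∈ xs → x ≢ y →
                    w x y < w′ x y → w y x < w′ y x →
                    (∀ {x y} → x ∈ xs → y ∈ xs → w x y ≤ w′ x y) →
                    sumPairs w xs < sumPairs w′ xs
  sumPairs-mono-< (here refl) (here refl) x≢y _ _ _ = ⊥-elim (x≢y refl)
  sumPairs-mono-< {_ ∷ xs} (here refl) (there y∈xs) _ wxy< _ w≤w′ =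
    +-mono-<-≤ (sum-map-mono-< (w _) (w′ _) y∈xs wxy< (w≤w′ (here refl) ∘ there))
               (sumPairs-mono-≤ xs λ x∈ y∈ → w≤w′ (there x∈) (there y∈))
  sumPairs-mono-< {_ ∷ xs} (there x∈xs) (here refl) _ _ wyx< w≤w′ =
    +-mono-<-≤ (sum-map-mono-< (w _) (w′ _) x∈xs wyx< (w≤w′ (here refl) ∘ there))
               (sumPairs-mono-≤ xs λ x∈ y∈ → w≤w′ (there x∈) (there y∈))
  sumPairs-mono-< {_ ∷ xs} (there x∈xs) (there y∈xs) x≢y wxy< wyx< w≤w′ =
    +-mono-≤-< (sum-map-mono-≤ (w _) (w′ _) xs (w≤w′ (here refl) ∘ there))
               (sumPairs-mono-< x∈xs y∈xs x≢y wxy< wyx< λ x∈ y∈ → w≤w′ (there x∈) (there y∈))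

Unique-map⁺ : (ψ : A → A) {xs : List A} → (∀ {x y} → x ∈ xs → y ∈ xs → ψ x ≡ ψ y → x ≡ y) →
              Unique xs → Unique (map ψ xs)
Unique-map⁺ ψ inj []           = []
Unique-map⁺ ψ inj (x∉xs ∷ uxs) =
  All-map⁺ (All.tabulate λ y∈xs ψx≡ψy → All.lookup x∉xs y∈xs (inj (here refl) (there y∈xs) ψx≡ψy))
  ∷ Unique-map⁺ ψ (λ x∈ y∈ → inj (there x∈) (there y∈)) uxs

∈-if⁻ : ∀ b {x y : A} → y ∈ (if b then [ x ] else []) → y ≡ x × b ≡ true
∈-if⁻ true (here y≡x) = y≡x , refl

Unique-if : ∀ b (x : A) → Unique (if b then [ x ] else [])
Unique-if true  x = [] ∷ []
Unique-if false x = []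

Unique-concatMap⁺ : {B : Set} (key : B → A) (f : A → List B) {xs : List A} → Unique xs →
                    (∀ x → Unique (f x)) → (∀ {x y} → y ∈ f x → key y ≡ x) →
                    Unique (concatMap f xs)
Unique-concatMap⁺ key f []           uf keyed = []
Unique-concatMap⁺ key f {x ∷ xs} (x∉xs ∷ uxs) uf keyed =
  ++⁺ (uf x) (Unique-concatMap⁺ key f uxs uf keyed) disjoint
  where
  disjoint : ∀ {y} → ¬ (y ∈ f x × y ∈ concatMap f xs)
  disjoint (y∈fx , y∈rest) with find (∈-concatMap⁻ f {xs = xs} y∈rest)
  ... | x′ , x′∈xs , y∈fx′ = All.lookup x∉xs x′∈xs (Eq.trans (sym (keyed y∈fx)) (keyed y∈fx′))

module _ (H : Graph n) where

  private
    Ascending : Fin n → Fin n → Bool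
    Ascending i j = (toℕ i <ᵇ toℕ j) ∧ H i j

    cell : Fin n → Fin n → List (Edge n)
    cell i j = if Ascending i j then [ (i , j) ] else []

    row : Fin n → List (Edge n)
    row i = concatMap (cell i) (allFinL n)

    ∈-row⁻ : ∀ {i e} → e ∈ row i → ∃ λ j → e ∈ cell i j
    ∈-row⁻ {i} e∈ = let j , _ , e∈cell = find (∈-concatMap⁻ (cell i) {xs = allFinL n} e∈) in j , e∈cell

  edges-∈⁻ : ∀ {i j} → (i , j) ∈ edges H → toℕ i < toℕ j × H i j ≡ true
  edges-∈⁻ e∈ with find (∈-concatMap⁻ row {xs = allFinL n} e∈)
  ... | i , _ , e∈row with ∈-row⁻ e∈row
  ...   | j , e∈cell with ∈-if⁻ (Ascending i j) e∈cell
  ...     | refl , asc = let i<ᵇj , hij = ∧-true⁻ asc in <ᵇ⇒< _ _ (Equivalence.from T-≡ i<ᵇj) , hij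

  edges-∈⁺ : ∀ {i j} → toℕ i < toℕ j → H i j ≡ true → (i , j) ∈ edges H
  edges-∈⁺ {i} {j} i<j hij =
    ∈-concatMap⁺ row {xs = allFinL n} (lose (∈-allFin i)
      (∈-concatMap⁺ (cell i) {xs = allFinL n} (lose (∈-allFin j) e∈cell)))
    where
    e∈cell : (i , j) ∈ cell i j
    e∈cell rewrite Equivalence.to T-≡ (<⇒<ᵇ i<j) | hij = here refl

  edges-unique : Unique (edges H)
  edges-unique = Unique-concatMap⁺ proj₁ row (allFin⁺ n) row-unique row-keyed
    where
    row-unique : ∀ i → Unique (row i)
    row-unique i = Unique-concatMap⁺ proj₂ (cell i) (allFin⁺ n) (λ j → Unique-if (Ascending i j) (i , j))
                     λ {j} e∈ → cong proj₂ (proj₁ (∈-if⁻ (Ascending i j) e∈))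

    row-keyed : ∀ {i e} → e ∈ row i → proj₁ e ≡ i
    row-keyed {i} e∈ with ∈-row⁻ e∈
    ... | j , e∈cell = cong proj₁ (proj₁ (∈-if⁻ (Ascending i j) e∈cell))

mkEdge : Fin n → Fin n → Edge n
mkEdge a b = if toℕ a <ᵇ toℕ b then (a , b) else (b , a)

mkEdge-< : {a b : Fin n} → toℕ a < toℕ b → mkEdge a b ≡ (a , b)
mkEdge-< a<b rewrite Equivalence.to T-≡ (<⇒<ᵇ a<b) = refl

mkEdge-> : {a b : Fin n} → toℕ b < toℕ a → mkEdge a b ≡ (b , a)
mkEdge-> {a = a} {b} b<a with toℕ a <ᵇ toℕ b in a<ᵇb
... | true  = ⊥-elim (<-asym b<a (<ᵇ⇒< _ _ (Equivalence.from T-≡ a<ᵇb)))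
... | false = refl

mkEdge-comm : (a b : Fin n) → mkEdge a b ≡ mkEdge b a
mkEdge-comm a b with <-cmp (toℕ a) (toℕ b)
... | tri< a<b _ _ = Eq.trans (mkEdge-< a<b) (sym (mkEdge-> a<b))
... | tri≈ _ a≡b _ rewrite toℕ-injective a≡b = refl
... | tri> _ _ b<a = Eq.trans (mkEdge-> b<a) (sym (mkEdge-< b<a))

mkEdge-∈ᵉ⁻ : (a b : Fin n) {c : Fin n} → c ∈ᵉ mkEdge a b → c ≡ a ⊎ c ≡ b
mkEdge-∈ᵉ⁻ a b c∈ with toℕ a <ᵇ toℕ b
... | true  = c∈
... | false = Sum.swap c∈

mkEdge-∈ᵉˡ : (a b : Fin n) → a ∈ᵉ mkEdge a b
mkEdge-∈ᵉˡ a b with toℕ a <ᵇ toℕ b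
... | true  = inj₁ refl
... | false = inj₂ refl

mkEdge-∈ᵉʳ : (a b : Fin n) → b ∈ᵉ mkEdge a b
mkEdge-∈ᵉʳ a b = subst (b ∈ᵉ_) (mkEdge-comm b a) (mkEdge-∈ᵉˡ b a)

mkEdge-∈-edges : (H : Graph n) {a b : Fin n} → a ≢ b → H a b ≡ true → H b a ≡ true →
                 mkEdge a b ∈ edges H
mkEdge-∈-edges H {a} {b} a≢b hab hba with <-cmp (toℕ a) (toℕ b)
... | tri< a<b _ _ rewrite mkEdge-< a<b = edges-∈⁺ H a<b hab
... | tri≈ _ a≡b _ = ⊥-elim (a≢b (toℕ-injective a≡b))
... | tri> _ _ b<a rewrite mkEdge-> b<a = edges-∈⁺ H b<a hba

∃-≢-Unique : DecidableEquality A → {xs : List A} → 2 ≤ length xs → Unique xs →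
             (z : A) → ∃ λ x → x ∈ xs × x ≢ z
∃-≢-Unique _≟A_ {x ∷ y ∷ _} (s≤s (s≤s z≤n)) ((x≢y ∷ _) ∷ _) z with x ≟A z
... | no x≢z   = x , here refl , x≢z
... | yes refl = y , there (here refl) , x≢y ∘ sym

neighbour-≢ : (G : Graph n) {v : Fin n} → 2 ≤ deg G v → (z : Fin n) → ∃ λ x → G v x ≡ true × x ≢ z
neighbour-≢ {n} G {v} 2≤deg z
  with ∃-≢-Unique _≟_ 2≤deg (Unique-filter⁺ (λ x → G v x ≟ᵇ true) (allFin⁺ n)) z
... | x , x∈ , x≢z = x , proj₂ (∈-filter⁻ (λ x → G v x ≟ᵇ true) {xs = allFinL n} x∈) , x≢z

module Contraction {G : Graph n} (s : IsSimple G) {v₁ v₂ : Fin n} (v₁v₂ : G v₁ v₂ ≡ true) where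

  G′ : Graph n
  G′ = contractPendant G v₁ v₂

  private
    v₁≢v₂ : v₁ ≢ v₂
    v₁≢v₂ = adjacent⇒≢ s v₁v₂

    v₂≢v₁ : v₂ ≢ v₁
    v₂≢v₁ = v₁≢v₂ ∘ sym

  G′-kept : ∀ {x y} → x ≢ v₂ → y ≢ v₂ → G x y ≡ true → G′ x y ≡ true
  G′-kept x≢v₂ y≢v₂ g
    rewrite ≢⇒==-false x≢v₂ | ≢⇒==-false y≢v₂ | ≢⇒==-false (adjacent⇒≢ s g) | g = refl

  G′-movedˡ : ∀ {y} → y ≢ v₁ → y ≢ v₂ → G v₂ y ≡ true → G′ v₁ y ≡ true
  G′-movedˡ {y} y≢v₁ y≢v₂ g
    rewrite ≢⇒==-false v₁≢v₂ | ≢⇒==-false y≢v₂ | ≢⇒==-false (y≢v₁ ∘ sym) | ==-refl v₁ | g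
    = ∨-zeroʳ (G v₁ y)

  G′-movedʳ : ∀ {x} → x ≢ v₁ → x ≢ v₂ → G x v₂ ≡ true → G′ x v₁ ≡ true
  G′-movedʳ {x} x≢v₁ x≢v₂ g
    rewrite ≢⇒==-false x≢v₂ | ≢⇒==-false v₁≢v₂ | ≢⇒==-false x≢v₁ | ==-refl v₁ | g
    = ∨-zeroʳ (G x v₁)

  merge : Fin n → Fin n
  merge x = if x == v₂ then v₁ else x

  merge-v₂ : merge v₂ ≡ v₁
  merge-v₂ rewrite ==-refl v₂ = refl

  merge-≢ : ∀ {x} → x ≢ v₂ → merge x ≡ x
  merge-≢ x≢v₂ rewrite ≢⇒==-false x≢v₂ = refl

  merge-hom : ∀ {x y} → G x y ≡ true → merge x ≡ merge y ⊎ G′ (merge x) (merge y) ≡ true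
  merge-hom {x} {y} g with x ≟ v₂ | y ≟ v₂
  ... | yes refl | yes refl = inj₁ refl
  ... | yes refl | no y≢v₂  = from-v₂ (y ≟ v₁) y≢v₂ g
    where
    from-v₂ : ∀ {y} → Dec (y ≡ v₁) → y ≢ v₂ → G v₂ y ≡ true → v₁ ≡ y ⊎ G′ v₁ y ≡ true
    from-v₂ (yes refl) _     _ = inj₁ refl
    from-v₂ (no y≢v₁) y≢v₂ g = inj₂ (G′-movedˡ y≢v₁ y≢v₂ g)
  ... | no x≢v₂  | yes refl = to-v₂ (x ≟ v₁) x≢v₂ g
    where
    to-v₂ : ∀ {x} → Dec (x ≡ v₁) → x ≢ v₂ → G x v₂ ≡ true → x ≡ v₁ ⊎ G′ x v₁ ≡ true
    to-v₂ (yes refl) _     _ = inj₁ refl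
    to-v₂ (no x≢v₁) x≢v₂ g = inj₂ (G′-movedʳ x≢v₁ x≢v₂ g)
  ... | no x≢v₂  | no y≢v₂  = inj₂ (G′-kept x≢v₂ y≢v₂ g)

  dist-merge : ∀ c d → dist G′ (merge c) (merge d) ≤ dist G c d
  dist-merge c d = dist-mono G G′ (λ k → reach-map G G′ merge merge-hom k)

  data ContractedEdge : Fin n → Fin n → Set where
    pendantˡ : ContractedEdge v₂ v₁
    pendantʳ : ContractedEdge v₁ v₂
    kept     : ∀ {x y} → x ≢ v₂ → y ≢ v₂ → G x y ≡ true → ContractedEdge x y
    movedˡ   : ∀ {y} → y ≢ v₁ → y ≢ v₂ → G v₂ y ≡ true → G v₁ y ≡ false → ContractedEdge v₁ y
    movedʳ   : ∀ {x} → x ≢ v₁ → x ≢ v₂ → G x v₂ ≡ true → G v₁ x ≡ false → ContractedEdge x v₁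

  ContractedEdge-sym : ∀ {x y} → ContractedEdge x y → ContractedEdge y x
  ContractedEdge-sym pendantˡ                 = pendantʳ
  ContractedEdge-sym pendantʳ                 = pendantˡ
  ContractedEdge-sym (kept x≢v₂ y≢v₂ g)       = kept y≢v₂ x≢v₂ (adjacent-sym s g)
  ContractedEdge-sym (movedˡ y≢v₁ y≢v₂ g ¬g)  = movedʳ y≢v₁ y≢v₂ (adjacent-sym s g) ¬g
  ContractedEdge-sym (movedʳ x≢v₁ x≢v₂ g ¬g)  = movedˡ x≢v₁ x≢v₂ (adjacent-sym s g) ¬g

  G′-from-v₂ : ∀ {y} → G′ v₂ y ≡ true → y ≡ v₁
  G′-from-v₂ g rewrite ==-refl v₂ = ==⇒≡ g

  G′-to-v₂ : ∀ {x} → x ≢ v₂ → G′ x v₂ ≡ true → x ≡ v₁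
  G′-to-v₂ x≢v₂ g rewrite ≢⇒==-false x≢v₂ | ==-refl v₂ = ==⇒≡ g

  G′-away : ∀ {x y} → x ≢ v₂ → y ≢ v₂ → G′ x y ≡ true →
            x ≢ y × (G x y ≡ true ⊎ (x ≡ v₁ × G v₂ y ≡ true) ⊎ (y ≡ v₁ × G x v₂ ≡ true))
  G′-away {x} {y} x≢v₂ y≢v₂ g rewrite ≢⇒==-false x≢v₂ | ≢⇒==-false y≢v₂ =
    let x≠y , via = ∧-true⁻ {not (x == y)} g in
    not-==⇒≢ x≠y ,
    Sum.map₂ (Sum.map ==∧ ==∧ ∘ ∨-true⁻ {(x == v₁) ∧ G v₂ y}) (∨-true⁻ {G x y} via)
    where
    not-==⇒≢ : not (x == y) ≡ true → x ≢ y
    not-==⇒≢ p refl rewrite ==-refl x with p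
    ... | ()
    ==∧ : ∀ {a b c} → (a == b) ∧ c ≡ true → a ≡ b × c ≡ true
    ==∧ {a} {b} p = let a=b , q = ∧-true⁻ {a == b} p in ==⇒≡ a=b , q

  v₁-edge-view : ∀ {y} → y ≢ v₁ → y ≢ v₂ → G v₂ y ≡ true → ContractedEdge v₁ y
  v₁-edge-view {y} y≢v₁ y≢v₂ g₂ with G v₁ y in g₁
  ... | true  = kept v₁≢v₂ y≢v₂ g₁
  ... | false = movedˡ y≢v₁ y≢v₂ g₂ g₁

  contracted-view : ∀ {x y} → G′ x y ≡ true → ContractedEdge x y
  contracted-view {x} {y} g = classify (x ≟ v₂) (y ≟ v₂)
    where
    classify : Dec (x ≡ v₂) → Dec (y ≡ v₂) → ContractedEdge x y
    classify (yes refl) _ rewrite G′-from-v₂ g = pendantˡ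
    classify (no x≢v₂) (yes refl) rewrite G′-to-v₂ x≢v₂ g = pendantʳ
    classify (no x≢v₂) (no y≢v₂) with G′-away x≢v₂ y≢v₂ g
    ... | _   , inj₁ gxy                 = kept x≢v₂ y≢v₂ gxy
    ... | x≢y , inj₂ (inj₁ (refl , g₂)) = v₁-edge-view (x≢y ∘ sym) y≢v₂ g₂
    ... | x≢y , inj₂ (inj₂ (refl , g₂)) =
      ContractedEdge-sym (v₁-edge-view x≢y x≢v₂ (adjacent-sym s g₂))

  -- lift x y is the end corresponding to x of the G-edge that the G′-edge xy comes from:
  -- only the edges that v₁ inherited from v₂ are sent back to v₂.
  lift : Fin n → Fin n → Fin n
  lift x y = if (x == v₁) ∧ not (y == v₂) ∧ not (G v₁ y) then v₂ else x

  lower : Fin n → Fin n → Fin n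
  lower a b = if (a == v₂) ∧ not (b == v₁) then v₁ else a

  lift-≢ : ∀ {x y} → x ≢ v₁ → lift x y ≡ x
  lift-≢ x≢v₁ rewrite ≢⇒==-false x≢v₁ = refl

  lift-kept : ∀ {y} → G v₁ y ≡ true → lift v₁ y ≡ v₁
  lift-kept {y} g rewrite ==-refl v₁ | g with y == v₂
  ... | true  = refl
  ... | false = refl

  lift-moved : ∀ {y} → y ≢ v₂ → G v₁ y ≡ false → lift v₁ y ≡ v₂
  lift-moved y≢v₂ ¬g rewrite ==-refl v₁ | ≢⇒==-false y≢v₂ | ¬g = refl

  lift-pendant : lift v₁ v₂ ≡ v₁
  lift-pendant rewrite ==-refl v₁ | ==-refl v₂ = refl

  lift-self : ∀ {x y} → G x y ≡ true → lift x y ≡ x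
  lift-self {x} = by-cases (x ≟ v₁)
    where
    by-cases : ∀ {x y} → Dec (x ≡ v₁) → G x y ≡ true → lift x y ≡ x
    by-cases (yes refl) g = lift-kept g
    by-cases (no x≢v₁)  _ = lift-≢ x≢v₁

  lower-≢ : ∀ {a b} → a ≢ v₂ → lower a b ≡ a
  lower-≢ a≢v₂ rewrite ≢⇒==-false a≢v₂ = refl

  lower-pendant : lower v₂ v₁ ≡ v₂
  lower-pendant rewrite ==-refl v₂ | ==-refl v₁ = refl

  lower-moved : ∀ {b} → b ≢ v₁ → lower v₂ b ≡ v₁
  lower-moved b≢v₁ rewrite ==-refl v₂ | ≢⇒==-false b≢v₁ = refl

  lift-adjacent : ∀ {x y} → ContractedEdge x y → G (lift x y) (lift y x) ≡ true
  lift-adjacent pendantˡ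
    rewrite lift-≢ {y = v₁} v₂≢v₁ | lift-pendant = adjacent-sym s v₁v₂
  lift-adjacent pendantʳ
    rewrite lift-≢ {y = v₁} v₂≢v₁ | lift-pendant = v₁v₂
  lift-adjacent (kept _ _ g)
    rewrite lift-self g | lift-self (adjacent-sym s g) = g
  lift-adjacent (movedˡ y≢v₁ y≢v₂ g ¬g)
    rewrite lift-moved y≢v₂ ¬g | lift-≢ {y = v₁} y≢v₁ = g
  lift-adjacent (movedʳ x≢v₁ x≢v₂ g ¬g)
    rewrite lift-moved x≢v₂ ¬g | lift-≢ {y = v₁} x≢v₁ = g

  lower-lift : ∀ {x y} → ContractedEdge x y → lower (lift x y) (lift y x) ≡ x
  lower-lift pendantˡ
    rewrite lift-≢ {y = v₁} v₂≢v₁ | lift-pendant = lower-pendant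
  lower-lift pendantʳ
    rewrite lift-≢ {y = v₁} v₂≢v₁ | lift-pendant = lower-≢ v₁≢v₂
  lower-lift (kept x≢v₂ _ g)
    rewrite lift-self g | lift-self (adjacent-sym s g) = lower-≢ x≢v₂
  lower-lift (movedˡ y≢v₁ y≢v₂ g ¬g)
    rewrite lift-moved y≢v₂ ¬g | lift-≢ {y = v₁} y≢v₁ = lower-moved y≢v₁
  lower-lift (movedʳ x≢v₁ x≢v₂ g ¬g)
    rewrite lift-moved x≢v₂ ¬g | lift-≢ {y = v₁} x≢v₁ = lower-≢ x≢v₂

  merge-lift : ∀ {x y} → ContractedEdge x y → merge (lift x y) ≡ x ⊎ merge (lift x y) ≡ y
  merge-lift pendantˡ rewrite lift-≢ {y = v₁} v₂≢v₁ = inj₂ merge-v₂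
  merge-lift pendantʳ rewrite lift-pendant = inj₁ (merge-≢ v₁≢v₂)
  merge-lift (kept x≢v₂ _ g) rewrite lift-self g = inj₁ (merge-≢ x≢v₂)
  merge-lift (movedˡ y≢v₁ y≢v₂ g ¬g) rewrite lift-moved y≢v₂ ¬g = inj₁ merge-v₂
  merge-lift (movedʳ x≢v₁ x≢v₂ g ¬g) rewrite lift-≢ {y = v₁} x≢v₁ = inj₁ (merge-≢ x≢v₂)

  liftEdge : Edge n → Edge n
  liftEdge (x , y) = mkEdge (lift x y) (lift y x)

  lowerEdge : Edge n → Edge n
  lowerEdge (a , b) = mkEdge (lower a b) (lower b a)

  liftEdge-mkEdge : ∀ a b → liftEdge (mkEdge a b) ≡ mkEdge (lift a b) (lift b a)
  liftEdge-mkEdge a b with toℕ a <ᵇ toℕ b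
  ... | true  = refl
  ... | false = mkEdge-comm _ _

  lowerEdge-mkEdge : ∀ a b → lowerEdge (mkEdge a b) ≡ mkEdge (lower a b) (lower b a)
  lowerEdge-mkEdge a b with toℕ a <ᵇ toℕ b
  ... | true  = refl
  ... | false = mkEdge-comm _ _

  private
    edges-view : ∀ {x y} → (x , y) ∈ edges G′ → toℕ x < toℕ y × ContractedEdge x y
    edges-view e∈ = let x<y , g = edges-∈⁻ G′ e∈ in x<y , contracted-view g

  liftEdge-∈ : ∀ {e} → e ∈ edges G′ → liftEdge e ∈ edges G
  liftEdge-∈ e∈ = let _ , c = edges-view e∈ ; g = lift-adjacent c in
    mkEdge-∈-edges G (adjacent⇒≢ s g) g (adjacent-sym s g)

  lowerEdge-liftEdge : ∀ {e} → e ∈ edges G′ → lowerEdge (liftEdge e) ≡ e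
  lowerEdge-liftEdge {x , y} e∈ = let x<y , c = edges-view e∈ in begin
    lowerEdge (mkEdge (lift x y) (lift y x))
      ≡⟨ lowerEdge-mkEdge (lift x y) (lift y x) ⟩
    mkEdge (lower (lift x y) (lift y x)) (lower (lift y x) (lift x y))
      ≡⟨ cong₂ mkEdge (lower-lift c) (lower-lift (ContractedEdge-sym c)) ⟩
    mkEdge x y
      ≡⟨ mkEdge-< x<y ⟩
    (x , y) ∎
    where open ≡-Reasoning

  liftEdge-injective : ∀ {e f} → e ∈ edges G′ → f ∈ edges G′ → liftEdge e ≡ liftEdge f → e ≡ f
  liftEdge-injective {e} {f} e∈ f∈ ψe≡ψf =
    Eq.trans (sym (lowerEdge-liftEdge e∈)) (Eq.trans (cong lowerEdge ψe≡ψf) (lowerEdge-liftEdge f∈))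

  merge-∈ᵉ-liftEdge : ∀ {e c} → e ∈ edges G′ → c ∈ᵉ liftEdge e → merge c ∈ᵉ e
  merge-∈ᵉ-liftEdge {x , y} e∈ c∈ with edges-view e∈ | mkEdge-∈ᵉ⁻ (lift x y) (lift y x) c∈
  ... | _ , ce | inj₁ refl = merge-lift ce
  ... | _ , ce | inj₂ refl = Sum.swap (merge-lift (ContractedEdge-sym ce))

  edist-liftEdge : ∀ {e f} → e ∈ edges G′ → f ∈ edges G′ →
                   edist G′ e f ≤ edist G (liftEdge e) (liftEdge f)
  edist-liftEdge {e} {f} e∈ f∈ = edist-glb G (liftEdge e) (liftEdge f) λ {c} {d} c∈ d∈ →
    ≤-trans (edist≤1+dist G′ e f (merge-∈ᵉ-liftEdge e∈ c∈) (merge-∈ᵉ-liftEdge f∈ d∈))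
            (s≤s (dist-merge c d))

  edist-liftEdge-< : ∀ {e f} → v₁ ∈ᵉ e → v₁ ∈ᵉ f →
                     (∀ {c d} → c ∈ᵉ liftEdge e → d ∈ᵉ liftEdge f → c ≢ d) →
                     edist G′ e f < edist G (liftEdge e) (liftEdge f)
  edist-liftEdge-< {e} {f} v₁∈e v₁∈f disjoint =
    ≤-trans (s≤s (edist-shared G′ e f v₁∈e v₁∈f)) (edist-disjoint G (liftEdge e) (liftEdge f) disjoint)

  We-contractPendant-< : ∀ {a b} → G v₁ a ≡ true → a ≢ v₂ → G v₂ b ≡ true → b ≢ v₁ →
                         G v₁ b ≡ false → We G′ < We G
  We-contractPendant-< {a} {b} g₁a a≢v₂ g₂b b≢v₁ ¬g₁b = begin-strict
    We G′                                         ≡⟨ pairSum≡sumPairs G′ (edges G′) ⟩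
    sumPairs (edist G′) (edges G′)                <⟨ sumPairs-mono-< (edist G′) w f∈ g∈ f≢g
                                                       (edist-liftEdge-< v₁∈f v₁∈g disjoint)
                                                       (edist-liftEdge-< v₁∈g v₁∈f (λ d∈ c∈ → disjoint c∈ d∈ ∘ sym))
                                                       edist-liftEdge ⟩
    sumPairs w (edges G′)                         ≡⟨ sumPairs-map (edist G) liftEdge (edges G′) ⟨
    sumPairs (edist G) (map liftEdge (edges G′))  ≤⟨ sumPairs-⊆ (edist G) (edist-sym s)
                                                       (Unique-map⁺ liftEdge liftEdge-injective (edges-unique G′))
                                                       lifted⊆ ⟩
    sumPairs (edist G) (edges G)                  ≡⟨ pairSum≡sumPairs G (edges G) ⟨
    We G                                          ∎
    where
    open ≤-Reasoning

    w : Edge n → Edge n → ℕ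
    w e f = edist G (liftEdge e) (liftEdge f)

    a≢v₁ : a ≢ v₁
    a≢v₁ = adjacent⇒≢ s g₁a ∘ sym

    b≢v₂ : b ≢ v₂
    b≢v₂ = adjacent⇒≢ s g₂b ∘ sym

    a≢b : a ≢ b
    a≢b refl with Eq.trans (sym g₁a) ¬g₁b
    ... | ()

    f₀ g₀ : Edge n
    f₀ = mkEdge v₁ a
    g₀ = mkEdge v₁ b

    f∈ : f₀ ∈ edges G′
    f∈ = mkEdge-∈-edges G′ (a≢v₁ ∘ sym) (G′-kept v₁≢v₂ a≢v₂ g₁a) (G′-kept a≢v₂ v₁≢v₂ (adjacent-sym s g₁a))

    g∈ : g₀ ∈ edges G′
    g∈ = mkEdge-∈-edges G′ (b≢v₁ ∘ sym) (G′-movedˡ b≢v₁ b≢v₂ g₂b) (G′-movedʳ b≢v₁ b≢v₂ (adjacent-sym s g₂b))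

    v₁∈f : v₁ ∈ᵉ f₀
    v₁∈f = mkEdge-∈ᵉˡ v₁ a

    v₁∈g : v₁ ∈ᵉ g₀
    v₁∈g = mkEdge-∈ᵉˡ v₁ b

    f≢g : f₀ ≢ g₀
    f≢g f≡g with mkEdge-∈ᵉ⁻ v₁ b (subst (a ∈ᵉ_) f≡g (mkEdge-∈ᵉʳ v₁ a))
    ... | inj₁ a≡v₁ = a≢v₁ a≡v₁
    ... | inj₂ a≡b  = a≢b a≡b

    lift-f : liftEdge f₀ ≡ mkEdge v₁ a
    lift-f rewrite liftEdge-mkEdge v₁ a | lift-kept g₁a | lift-≢ {y = v₁} a≢v₁ = refl

    lift-g : liftEdge g₀ ≡ mkEdge v₂ b
    lift-g rewrite liftEdge-mkEdge v₁ b | lift-moved b≢v₂ ¬g₁b | lift-≢ {y = v₁} b≢v₁ = refl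

    disjoint : ∀ {c d} → c ∈ᵉ liftEdge f₀ → d ∈ᵉ liftEdge g₀ → c ≢ d
    disjoint c∈ d∈ with mkEdge-∈ᵉ⁻ v₁ a (subst (_ ∈ᵉ_) lift-f c∈)
                      | mkEdge-∈ᵉ⁻ v₂ b (subst (_ ∈ᵉ_) lift-g d∈)
    ... | inj₁ refl | inj₁ refl = v₁≢v₂
    ... | inj₁ refl | inj₂ refl = b≢v₁ ∘ sym
    ... | inj₂ refl | inj₁ refl = a≢v₂
    ... | inj₂ refl | inj₂ refl = a≢b

    lifted⊆ : map liftEdge (edges G′) ⊆ edges G
    lifted⊆ e∈ with ∈-map⁻ liftEdge e∈
    ... | e , e∈G′ , refl = liftEdge-∈ e∈G′

lemma3 : ∀ {n : ℕ} (G : Graph n) (v₁ v₂ : Fin n) →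
    IsSimple G → Connected G → G v₁ v₂ ≡ true → IsCutEdge G v₁ v₂ →
    2 ≤ deg G v₁ → 2 ≤ deg G v₂ →
    We (contractPendant G v₁ v₂) < We G
lemma3 G v₁ v₂ s conn v₁v₂ cut deg₁ deg₂
  with neighbour-≢ G deg₁ v₂ | neighbour-≢ G deg₂ v₁
... | a , g₁a , a≢v₂ | b , g₂b , b≢v₁ with G v₁ b in g₁b
...   | true  = ⊥-elim (cut (connected-deleteEdge-triangle s g₁b g₂b conn))
...   | false = Contraction.We-contractPendant-< s v₁v₂ g₁a a≢v₂ g₂b b≢v₁ g₁b
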